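{- Let $\zeta$ be the convolution inverse of the character $\overline\eta$ on convex geometries. Then for every finite set $I$ and every convex geometry $g$ on $I$, $\zeta_I(g)=1$ if $g$ is discrete and $\zeta_I(g)=0$ otherwise.
   Context: A convex geometry on finite $I$ is $g:2^I\to2^I$ with $A\subseteq g(A)$, $g(g(A))=g(A)$, monotone, $g(\emptyset)=\emptyset$, and anti-exchange (if $a\ne b$, $a,b\notin g(A)$, $a\in g(A\cup\{b\})$ then $b\notin g(A\cup\{a\})$). Convex sets: $g(K)=K$. $g$ is discrete if $g(A)=A$ for all $A\subseteq I$. For convex $S$, restriction $g|_S(A)=g(A)$ ($A\subseteq S$) and contraction $g/_S(B)=g(S\cup B)\cap(I\setminus S)$ ($B\subseteq I\setminus S$). A character $\psi$ assigns to each convex geometry $g$ on each finite set $I$ a scalar $\psi_I(g)$ in a field of characteristic $\ne2$, invariant under relabeling, multiplicative on direct sums $(g_1\oplus g_2)(A)=g_1(A\cap S)\cup g_2(A\cap T)$, and equal to $1$ on the empty geometry. Convolution: $(\psi*\psi')_I(g)=\sum_{S\sqcup T=I,\ S\text{ convex}}\psi_S(g|_S)\psi'_T(g/_S)$; the unit is $\varepsilon_I=1$ if $I=\emptyset$, $0$ otherwise. $\eta_I(g)=1$ for all $g$, and $\overline\eta_I(g)=(-1)^{|I|}$. -}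

module Defs where

open import Level using (Level; _⊔_) renaming (suc to lsuc)
open import Data.Nat.Base using (ℕ; zero; suc) renaming (_+_ to _+ℕ_)
open import Data.Bool.Base using (Bool; true; false; if_then_else_)
open import Data.Fin.Base using (Fin)
open import Data.Fin.Subset using (Subset; _∈_; _∉_; _⊆_; _∪_; ⁅_⁆; ⊥; ∁)
open import Data.Fin.Permutation using (Permutation′; _⟨$⟩ʳ_; _⟨$⟩ˡ_)
open import Data.Vec.Base using (Vec; []; _∷_; _++_; take; drop; tabulate; lookup)
open import Data.Vec.Properties using (≡-dec)
import Data.Bool.Properties as BoolP
open import Data.List.Base using (List; []; _∷_; map) renaming (_++_ to _++ᴸ_)
open import Data.Product.Base using (Σ; _×_)
open import Relation.Nullary using (¬_; does)
open import Relation.Binary.PropositionalEquality using (_≡_)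
open import Algebra.Bundles using (CommutativeRing)

record Field (c ℓ : Level) : Set (lsuc (c ⊔ ℓ)) where
  field
    commRing : CommutativeRing c ℓ
  open CommutativeRing commRing public
  field
    1≉0 : ¬ (1# ≈ 0#)
    inverse : ∀ x → ¬ (x ≈ 0#) → Σ Carrier (λ y → (x * y) ≈ 1#)

CharNot2 : ∀ {c ℓ} → Field c ℓ → Set ℓ
CharNot2 F = ¬ ((1# + 1#) ≈ 0#)
  where open Field F

-- Set operators on the finite set I = Fin n (subsets as Data.Fin.Subset)

Op : ℕ → Set
Op n = Subset n → Subset n

record IsConvexGeometry {n : ℕ} (g : Op n) : Set where
  field
    extensive    : ∀ A → A ⊆ g A
    idempotent   : ∀ A → g (g A) ≡ g A
    monotone     : ∀ A B → A ⊆ B → g A ⊆ g B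
    empty        : g ⊥ ≡ ⊥
    antiExchange : ∀ A (a b : Fin n) → ¬ (a ≡ b) → a ∉ g A → b ∉ g A →
                   a ∈ g (A ∪ ⁅ b ⁆) → b ∉ g (A ∪ ⁅ a ⁆)

Discrete : ∀ {n} → Op n → Set
Discrete g = ∀ A → g A ≡ A

Convex : ∀ {n} → Op n → Subset n → Set
Convex g K = g K ≡ K

-- Transport between a subset S ⊆ Fin n and Fin (size S),
-- enumerating the elements of S in increasing order.

size : ∀ {n} → Subset n → ℕ
size []          = 0
size (true ∷ S)  = suc (size S)
size (false ∷ S) = size S

lift : ∀ {n} (S : Subset n) → Subset (size S) → Subset n
lift []          A       = []
lift (true ∷ S)  (a ∷ A) = a ∷ lift S A
lift (false ∷ S) A       = false ∷ lift S A

restr : ∀ {n} (S : Subset n) → Subset n → Subset (size S)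
restr []          []      = []
restr (true ∷ S)  (b ∷ B) = b ∷ restr S B
restr (false ∷ S) (b ∷ B) = restr S B

restriction : ∀ {n} → Op n → (S : Subset n) → Op (size S)
restriction g S A = restr S (g (lift S A))

contraction : ∀ {n} → Op n → (S : Subset n) → Op (size (∁ S))
contraction g S B = restr (∁ S) (g (S ∪ lift (∁ S) B))

directSum : ∀ {m k} → Op m → Op k → Op (m +ℕ k)
directSum {m} {k} g₁ g₂ A = g₁ (take m A) ++ g₂ (drop m A)

relabel : ∀ {n} → Permutation′ n → Op n → Op n
relabel σ g B = tabulate (λ j → lookup (g (tabulate (λ i → lookup B (σ ⟨$⟩ʳ i)))) (σ ⟨$⟩ˡ j))

allSubsets : ∀ n → List (Subset n)
allSubsets zero    = [] ∷ []
allSubsets (suc n) = map (true ∷_) (allSubsets n) ++ᴸ map (false ∷_) (allSubsets n)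

module _ {c ℓ} (F : Field c ℓ) where
  open Field F

  -- a (pre)character: a scalar for each operator on each Fin n;
  -- only the values on convex geometries are meaningful.
  Char : Set c
  Char = ∀ n → Op n → Carrier

  sumF : List Carrier → Carrier
  sumF []       = 0#
  sumF (x ∷ xs) = x + sumF xs

  record IsCharacter (ψ : Char) : Set (c ⊔ ℓ) where
    field
      extensional : ∀ n (g g′ : Op n) → IsConvexGeometry g →
                    (∀ A → g A ≡ g′ A) → ψ n g ≈ ψ n g′
      relabelInv  : ∀ n (σ : Permutation′ n) (g : Op n) → IsConvexGeometry g →
                    ψ n (relabel σ g) ≈ ψ n g
      multiplicative : ∀ m k (g₁ : Op m) (g₂ : Op k) →
                    IsConvexGeometry g₁ → IsConvexGeometry g₂ →
                    ψ (m +ℕ k) (directSum g₁ g₂) ≈ (ψ m g₁ * ψ k g₂)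
      unit        : ∀ (g : Op 0) → IsConvexGeometry g → ψ 0 g ≈ 1#

  conv : Char → Char → Char
  conv ψ ψ′ n g = sumF (map term (allSubsets n))
    where
    term : Subset n → Carrier
    term S = if does (≡-dec BoolP._≟_ (g S) S)
             then ψ (size S) (restriction g S) * ψ′ (size (∁ S)) (contraction g S)
             else 0#

  ε : Char
  ε zero    g = 1#
  ε (suc n) g = 0#

  signPow : ℕ → Carrier
  signPow zero    = 1#
  signPow (suc n) = - 1# * signPow n

  ηbar : Char
  ηbar n g = signPow n

  IsConvInverse : Char → Char → Set ℓ
  IsConvInverse ζ ψ = ∀ n (g : Op n) → IsConvexGeometry g →
                      (conv ζ ψ n g ≈ ε n g) × (conv ψ ζ n g ≈ ε n g)

-- For I ≠ ∅, (ζ * η̄)(g) = 0 reads Σ_{S convex} ζ(g|_S) (-1)^{|I∖S|} = 0, and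
-- for S ≠ I the induction hypothesis says that ζ(g|_S) is 1 when S is free (all subsets of S are
-- convex) and 0 otherwise.  Hence ζ(g) = [I free] - Σ_{T free} (-1)^{|I∖T|}, and this signed count
-- of free sets vanishes for every convex geometry on a nonempty set: removing an extreme point e
-- (one with I - e convex) splits it into the signed counts of the deletion and the contraction at e,
-- both convex geometries on I - e, which vanish by induction (or cancel when I = {e}).

module Submission where

open import Defs hiding (ε)
open import Level using (Level)
open import Algebra.Bundles using (CommutativeMonoid; AbelianGroup)
import Algebra.Properties.CommutativeSemigroup as CommutativeSemigroupProperties
import Algebra.Properties.Group as GroupProperties
import Algebra.Properties.Ring as RingProperties
open import Data.Bool.Base using (true; false; _∨_; if_then_else_)
import Data.Bool.Properties as Bool
open import Data.Empty using (⊥-elim)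
open import Data.Fin.Base using (Fin; zero; suc)
open import Data.Fin.Properties using (suc-injective; any?) renaming (_≟_ to _≟ᶠ_)
open import Data.Fin.Subset
open import Data.Fin.Subset.Properties
open import Data.List.Base using (List; []; _∷_; map) renaming (_++_ to _++ᴸ_)
import Data.List.Properties as List
open import Data.Nat.Base using (ℕ; zero; suc; _<_; _≤_; s≤s)
open import Data.Nat.Induction using (<-rec)
import Data.Nat.Properties as ℕ
open import Data.Product.Base using (∃; _×_; _,_; proj₁)
open import Data.Sum.Base using (_⊎_; inj₁; inj₂; map₂)
open import Data.Vec.Base using ([]; _∷_; lookup; _[_]≔_; here; there)
open import Data.Vec.Properties using (≡-dec; []=⇒lookup; ∷-injectiveʳ)
open import Function.Base using (_∘_)
open import Function.Bundles using (_⇔_; mk⇔; Equivalence)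
open import Relation.Nullary using (¬_; Dec; yes; no; does; ¬?)
open import Relation.Nullary.Decidable using (_×-dec_; _→-dec_; map′; decidable-stable)
open import Relation.Binary.PropositionalEquality as ≡ using (_≡_; _≢_; refl; cong; cong₂; subst)

private
  variable
    n : ℕ

x∈p∪⁅y⁆⁻ : ∀ (p : Subset n) {x y} → x ∈ p ∪ ⁅ y ⁆ → x ∈ p ⊎ x ≡ y
x∈p∪⁅y⁆⁻ p {y = y} h = map₂ (x∈⁅y⁆⇒x≡y y) (x∈p∪q⁻ p ⁅ y ⁆ h)

x∈p⇒x∈p∪⁅y⁆ : ∀ {p : Subset n} {x} y → x ∈ p → x ∈ p ∪ ⁅ y ⁆
x∈p⇒x∈p∪⁅y⁆ y h = x∈p∪q⁺ (inj₁ h)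

x∈p∪⁅x⁆ : ∀ (p : Subset n) x → x ∈ p ∪ ⁅ x ⁆
x∈p∪⁅x⁆ p x = x∈p∪q⁺ (inj₂ (x∈⁅x⁆ x))

p⊆r∧x∈r⇒p∪⁅x⁆⊆r : ∀ {p r : Subset n} {x} → p ⊆ r → x ∈ r → p ∪ ⁅ x ⁆ ⊆ r
p⊆r∧x∈r⇒p∪⁅x⁆⊆r {p = p} p⊆r x∈r h with x∈p∪⁅y⁆⁻ p h
... | inj₁ y∈p = p⊆r y∈p
... | inj₂ refl = x∈r

p⊆q⇒p∪⁅x⁆⊆q∪⁅x⁆ : ∀ {p q : Subset n} {x} → p ⊆ q → p ∪ ⁅ x ⁆ ⊆ q ∪ ⁅ x ⁆
p⊆q⇒p∪⁅x⁆⊆q∪⁅x⁆ {q = q} {x} p⊆q = p⊆r∧x∈r⇒p∪⁅x⁆⊆r (x∈p⇒x∈p∪⁅y⁆ x ∘ p⊆q) (x∈p∪⁅x⁆ q x)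

x∈p─q⇒x∉q : ∀ (p q : Subset n) {x} → x ∈ p ─ q → x ∉ q
x∈p─q⇒x∉q (true ∷ p)  (false ∷ q) here      ()
x∈p─q⇒x∉q (_ ∷ p)     (_ ∷ q)     (there h) (there k) = x∈p─q⇒x∉q p q h k

x∈p-y⇒x∈p : ∀ {p : Subset n} {x y} → x ∈ p - y → x ∈ p
x∈p-y⇒x∈p {p = p} {y = y} = p─q⊆p p ⁅ y ⁆

x∈p-y⇒x≢y : ∀ {p : Subset n} {x y} → x ∈ p - y → x ≢ y
x∈p-y⇒x≢y {p = p} {y = y} h refl = x∈p─q⇒x∉q p ⁅ y ⁆ h (x∈⁅x⁆ y)

x∉p-x : ∀ (p : Subset n) x → x ∉ p - x
x∉p-x p x h = x∈p-y⇒x≢y h refl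

p-x∪⁅x⁆≡p : ∀ {p : Subset n} {x} → x ∈ p → (p - x) ∪ ⁅ x ⁆ ≡ p
p-x∪⁅x⁆≡p {p = p} {x} x∈p = ⊆-antisym (p⊆r∧x∈r⇒p∪⁅x⁆⊆r x∈p-y⇒x∈p x∈p) p⊆p-x∪⁅x⁆
  where
  p⊆p-x∪⁅x⁆ : p ⊆ (p - x) ∪ ⁅ x ⁆
  p⊆p-x∪⁅x⁆ {y} y∈p with y ≟ᶠ x
  ... | yes refl = x∈p∪⁅x⁆ (p - x) x
  ... | no y≢x   = x∈p⇒x∈p∪⁅y⁆ x (x∈p∧x≢y⇒x∈p-y y∈p y≢x)

p∪⁅x⁆-x≡p : ∀ {p : Subset n} {x} → x ∉ p → (p ∪ ⁅ x ⁆) - x ≡ p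
p∪⁅x⁆-x≡p {p = p} {x} x∉p = ⊆-antisym ⊆p p⊆
  where
  ⊆p : (p ∪ ⁅ x ⁆) - x ⊆ p
  ⊆p y∈ with x∈p∪⁅y⁆⁻ p (x∈p-y⇒x∈p y∈)
  ... | inj₁ y∈p = y∈p
  ... | inj₂ y≡x = ⊥-elim (x∈p-y⇒x≢y y∈ y≡x)
  p⊆ : p ⊆ (p ∪ ⁅ x ⁆) - x
  p⊆ y∈p = x∈p∧x≢y⇒x∈p-y (x∈p⇒x∈p∪⁅y⁆ x y∈p) (λ { refl → x∉p y∈p })

p∪⁅x⁆≡q∪⁅x⁆⇒p≡q : ∀ {p q : Subset n} {x} → x ∉ p → x ∉ q → p ∪ ⁅ x ⁆ ≡ q ∪ ⁅ x ⁆ → p ≡ q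
p∪⁅x⁆≡q∪⁅x⁆⇒p≡q {x = x} x∉p x∉q eq =
  ≡.trans (≡.sym (p∪⁅x⁆-x≡p x∉p)) (≡.trans (cong (_- x) eq) (p∪⁅x⁆-x≡p x∉q))

p∪⁅x⁆∪⁅y⁆≡p∪⁅y⁆∪⁅x⁆ : ∀ (p : Subset n) x y → (p ∪ ⁅ x ⁆) ∪ ⁅ y ⁆ ≡ (p ∪ ⁅ y ⁆) ∪ ⁅ x ⁆
p∪⁅x⁆∪⁅y⁆≡p∪⁅y⁆∪⁅x⁆ p x y = begin
  (p ∪ ⁅ x ⁆) ∪ ⁅ y ⁆  ≡⟨ ∪-assoc p ⁅ x ⁆ ⁅ y ⁆ ⟩
  p ∪ (⁅ x ⁆ ∪ ⁅ y ⁆)  ≡⟨ cong (p ∪_) (∪-comm ⁅ x ⁆ ⁅ y ⁆) ⟩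
  p ∪ (⁅ y ⁆ ∪ ⁅ x ⁆)  ≡⟨ ∪-assoc p ⁅ y ⁆ ⁅ x ⁆ ⟨
  (p ∪ ⁅ y ⁆) ∪ ⁅ x ⁆  ∎
  where open ≡.≡-Reasoning

p⊆q∧x∉q⇒p∪⁅x⁆∩q≡p : ∀ {p q : Subset n} {x} → p ⊆ q → x ∉ q → (p ∪ ⁅ x ⁆) ∩ q ≡ p
p⊆q∧x∉q⇒p∪⁅x⁆∩q≡p {p = p} {q} {x} p⊆q x∉q = ⊆-antisym ⊆p (λ y∈p → x∈p∩q⁺ (x∈p⇒x∈p∪⁅y⁆ x y∈p , p⊆q y∈p))
  where
  ⊆p : (p ∪ ⁅ x ⁆) ∩ q ⊆ p
  ⊆p y∈ with x∈p∩q⁻ (p ∪ ⁅ x ⁆) q y∈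
  ... | y∈p∪x , y∈q with x∈p∪⁅y⁆⁻ p y∈p∪x
  ...   | inj₁ y∈p = y∈p
  ...   | inj₂ refl = ⊥-elim (x∉q y∈q)

p[x]≔true≡p∪⁅x⁆ : ∀ (p : Subset n) x → p [ x ]≔ true ≡ p ∪ ⁅ x ⁆
p[x]≔true≡p∪⁅x⁆ (b ∷ p) zero    = cong₂ _∷_ (≡.sym (Bool.∨-zeroʳ b)) (≡.sym (∪-identityʳ p))
p[x]≔true≡p∪⁅x⁆ (b ∷ p) (suc x) = cong₂ _∷_ (≡.sym (Bool.∨-identityʳ b)) (p[x]≔true≡p∪⁅x⁆ p x)

p⊆q∧p≢q⇒p⊂q : ∀ {p q : Subset n} → p ⊆ q → p ≢ q → p ⊂ q
p⊆q∧p≢q⇒p⊂q {p = p} {q} p⊆q p≢q with any? (λ x → x ∈? q ×-dec ¬? (x ∈? p))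
... | yes (x , x∈q , x∉p) = p⊆q , x , x∈q , x∉p
... | no ∄x = ⊥-elim (p≢q (⊆-antisym p⊆q q⊆p))
  where
  q⊆p : q ⊆ p
  q⊆p {x} x∈q = decidable-stable (x ∈? p) (λ x∉p → ∄x (x , x∈q , x∉p))

∀-subset? : {P : Subset n → Set} → (∀ U → Dec (P U)) → Dec (∀ U → P U)
∀-subset? P? = map′
  (λ ∄U U → decidable-stable (P? U) (λ ¬PU → ∄U (U , ¬PU)))
  (λ ∀U (U , ¬PU) → ¬PU (∀U U))
  (¬? (anySubset? (¬? ∘ P?)))

size≡∣p∣ : ∀ (p : Subset n) → size p ≡ ∣ p ∣
size≡∣p∣ []          = refl
size≡∣p∣ (true ∷ p)  = cong suc (size≡∣p∣ p)
size≡∣p∣ (false ∷ p) = size≡∣p∣ p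

size⊤ : ∀ n → size (⊤ {n}) ≡ n
size⊤ zero    = refl
size⊤ (suc n) = cong suc (size⊤ n)

size∁⊤ : ∀ n → size (∁ (⊤ {n})) ≡ 0
size∁⊤ zero    = refl
size∁⊤ (suc n) = size∁⊤ n

p≢⊤⇒size<n : ∀ (p : Subset n) → p ≢ ⊤ → size p < n
p≢⊤⇒size<n {n} p p≢⊤ rewrite size≡∣p∣ p with ℕ.m≤n⇒m<n∨m≡n (∣p∣≤n p)
... | inj₁ ∣p∣<n = ∣p∣<n
... | inj₂ ∣p∣≡n = ⊥-elim (p≢⊤ (∣p∣≡n⇒p≡⊤ ∣p∣≡n))

size∁-insert : ∀ (p : Subset n) x → x ∉ p → size (∁ p) ≡ suc (size (∁ (p [ x ]≔ true)))
size∁-insert (true ∷ p)  zero    x∉p = ⊥-elim (x∉p here)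
size∁-insert (false ∷ p) zero    x∉p = refl
size∁-insert (true ∷ p)  (suc x) x∉p = size∁-insert p x (x∉p ∘ there)
size∁-insert (false ∷ p) (suc x) x∉p = cong suc (size∁-insert p x (x∉p ∘ there))

enum : ∀ (S : Subset n) → Fin (size S) → Fin n
enum (true ∷ S)  zero    = zero
enum (true ∷ S)  (suc i) = suc (enum S i)
enum (false ∷ S) i       = suc (enum S i)

enum-injective : ∀ (S : Subset n) {i j} → enum S i ≡ enum S j → i ≡ j
enum-injective (true ∷ S)  {zero}  {zero}  _  = refl
enum-injective (true ∷ S)  {suc i} {suc j} eq = cong suc (enum-injective S (suc-injective eq))
enum-injective (false ∷ S)                 eq = enum-injective S (suc-injective eq)

∈-restr⁻ : ∀ (S Y : Subset n) {i} → i ∈ restr S Y → enum S i ∈ Y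
∈-restr⁻ (true ∷ S)  (y ∷ Y) {zero}  here      = here
∈-restr⁻ (true ∷ S)  (y ∷ Y) {suc i} (there h) = there (∈-restr⁻ S Y h)
∈-restr⁻ (false ∷ S) (y ∷ Y)         h         = there (∈-restr⁻ S Y h)

∈-restr⁺ : ∀ (S Y : Subset n) {i} → enum S i ∈ Y → i ∈ restr S Y
∈-restr⁺ (true ∷ S)  (y ∷ Y) {zero}  here      = here
∈-restr⁺ (true ∷ S)  (y ∷ Y) {suc i} (there h) = there (∈-restr⁺ S Y h)
∈-restr⁺ (false ∷ S) (y ∷ Y)         (there h) = ∈-restr⁺ S Y h

∈-lift⁻ : ∀ (S : Subset n) A {i} → enum S i ∈ lift S A → i ∈ A
∈-lift⁻ (true ∷ S)  (a ∷ A) {zero}  here      = here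
∈-lift⁻ (true ∷ S)  (a ∷ A) {suc i} (there h) = there (∈-lift⁻ S A h)
∈-lift⁻ (false ∷ S) A               (there h) = ∈-lift⁻ S A h

∈-lift⁺ : ∀ (S : Subset n) A {i} → i ∈ A → enum S i ∈ lift S A
∈-lift⁺ (true ∷ S)  (a ∷ A) {zero}  here      = here
∈-lift⁺ (true ∷ S)  (a ∷ A) {suc i} (there h) = there (∈-lift⁺ S A h)
∈-lift⁺ (false ∷ S) A               h         = there (∈-lift⁺ S A h)

∈-lift⇒∈-enum : ∀ (S : Subset n) A {x} → x ∈ lift S A → ∃ λ i → enum S i ≡ x
∈-lift⇒∈-enum (true ∷ S) (a ∷ A) here = zero , refl
∈-lift⇒∈-enum (true ∷ S) (a ∷ A) (there h) with ∈-lift⇒∈-enum S A h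
... | i , refl = suc i , refl
∈-lift⇒∈-enum (false ∷ S) A (there h) with ∈-lift⇒∈-enum S A h
... | i , refl = i , refl

lift⊆ : ∀ (S : Subset n) A → lift S A ⊆ S
lift⊆ (true ∷ S)  (a ∷ A) here      = here
lift⊆ (true ∷ S)  (a ∷ A) (there h) = there (lift⊆ S A h)
lift⊆ (false ∷ S) A       (there h) = there (lift⊆ S A h)

lift-mono : ∀ (S : Subset n) {A B} → A ⊆ B → lift S A ⊆ lift S B
lift-mono S {A} {B} A⊆B x∈ with ∈-lift⇒∈-enum S A x∈
... | i , refl = ∈-lift⁺ S B (A⊆B (∈-lift⁻ S A x∈))

restr-mono : ∀ (S : Subset n) {Y Z} → Y ⊆ Z → restr S Y ⊆ restr S Z
restr-mono S {Y} {Z} Y⊆Z i∈ = ∈-restr⁺ S Z (Y⊆Z (∈-restr⁻ S Y i∈))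

restr-lift : ∀ (S : Subset n) A → restr S (lift S A) ≡ A
restr-lift []          []      = refl
restr-lift (true ∷ S)  (a ∷ A) = cong (a ∷_) (restr-lift S A)
restr-lift (false ∷ S) A       = restr-lift S A

lift-restr : ∀ (S Y : Subset n) → Y ⊆ S → lift S (restr S Y) ≡ Y
lift-restr []          []          _    = refl
lift-restr (true ∷ S)  (y ∷ Y)     Y⊆S  = cong (y ∷_) (lift-restr S Y (drop-∷-⊆ Y⊆S))
lift-restr (false ∷ S) (true ∷ Y)  Y⊆S  with Y⊆S here
... | ()
lift-restr (false ∷ S) (false ∷ Y) Y⊆S  = cong (false ∷_) (lift-restr S Y (drop-∷-⊆ Y⊆S))

lift-⊥ : ∀ (S : Subset n) → lift S ⊥ ≡ ⊥
lift-⊥ []          = refl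
lift-⊥ (true ∷ S)  = cong (false ∷_) (lift-⊥ S)
lift-⊥ (false ∷ S) = cong (false ∷_) (lift-⊥ S)

restr-⊥ : ∀ (S : Subset n) → restr S ⊥ ≡ ⊥
restr-⊥ []          = refl
restr-⊥ (true ∷ S)  = cong (false ∷_) (restr-⊥ S)
restr-⊥ (false ∷ S) = restr-⊥ S

lift-∪⁅⁆ : ∀ (S : Subset n) A i → lift S (A ∪ ⁅ i ⁆) ≡ lift S A ∪ ⁅ enum S i ⁆
lift-∪⁅⁆ (true ∷ S)  (a ∷ A) zero    = cong ((a ∨ true) ∷_)
  (≡.trans (cong (lift S) (∪-identityʳ A)) (≡.sym (∪-identityʳ (lift S A))))
lift-∪⁅⁆ (true ∷ S)  (a ∷ A) (suc i) = cong ((a ∨ false) ∷_) (lift-∪⁅⁆ S A i)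
lift-∪⁅⁆ (false ∷ S) A       i       = cong (false ∷_) (lift-∪⁅⁆ S A i)

subst-∷ : ∀ {m k} (m≡k : m ≡ k) a (A : Subset k) →
          subst Subset (≡.sym (cong suc m≡k)) (a ∷ A) ≡ a ∷ subst Subset (≡.sym m≡k) A
subst-∷ refl a A = refl

lift-⊤ : ∀ n (A : Subset n) → lift ⊤ (subst Subset (≡.sym (size⊤ n)) A) ≡ A
lift-⊤ zero    []      = refl
lift-⊤ (suc n) (a ∷ A) rewrite subst-∷ (size⊤ n) a A = cong (a ∷_) (lift-⊤ n A)

restr-⊤ : ∀ n (B : Subset n) → restr ⊤ B ≡ subst Subset (≡.sym (size⊤ n)) B
restr-⊤ zero    []      = refl
restr-⊤ (suc n) (b ∷ B) = ≡.trans (cong (b ∷_) (restr-⊤ n B)) (≡.sym (subst-∷ (size⊤ n) b B))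

module SubsetSum {c ℓ} (M : CommutativeMonoid c ℓ) where
  open CommutativeMonoid M renaming (refl to ≈-refl)
  open CommutativeSemigroupProperties commutativeSemigroup using (interchange)
  open import Relation.Binary.Reasoning.Setoid setoid

  ΣS : ∀ n → (Subset n → Carrier) → Carrier
  ΣS zero    f = f []
  ΣS (suc n) f = ΣS n (f ∘ (true ∷_)) ∙ ΣS n (f ∘ (false ∷_))

  ΣS-cong : ∀ {f h : Subset n → Carrier} → (∀ T → f T ≈ h T) → ΣS n f ≈ ΣS n h
  ΣS-cong {zero}  f≈h = f≈h []
  ΣS-cong {suc n} f≈h = ∙-cong (ΣS-cong (f≈h ∘ (true ∷_))) (ΣS-cong (f≈h ∘ (false ∷_)))

  ΣS-∙ : ∀ (f h : Subset n → Carrier) → ΣS n (λ T → f T ∙ h T) ≈ ΣS n f ∙ ΣS n h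
  ΣS-∙ {zero}  f h = ≈-refl
  ΣS-∙ {suc n} f h = trans
    (∙-cong (ΣS-∙ (f ∘ (true ∷_)) (h ∘ (true ∷_))) (ΣS-∙ (f ∘ (false ∷_)) (h ∘ (false ∷_))))
    (interchange _ _ _ _)

  ΣS-ε : ∀ {f : Subset n → Carrier} → (∀ T → f T ≈ ε) → ΣS n f ≈ ε
  ΣS-ε {zero}  f≈ε = f≈ε []
  ΣS-ε {suc n} f≈ε = trans (∙-cong (ΣS-ε (f≈ε ∘ (true ∷_))) (ΣS-ε (f≈ε ∘ (false ∷_)))) (identityʳ ε)

  ΣS-single : ∀ {f : Subset n → Carrier} p → (∀ T → T ≢ p → f T ≈ ε) → ΣS n f ≈ f p
  ΣS-single {zero}  []        _ = ≈-refl
  ΣS-single {suc n} (true ∷ p) f≈ε = trans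
    (∙-cong (ΣS-single p (λ T T≢p → f≈ε (true ∷ T) (T≢p ∘ ∷-injectiveʳ)))
            (ΣS-ε (λ T → f≈ε (false ∷ T) λ ())))
    (identityʳ _)
  ΣS-single {suc n} (false ∷ p) f≈ε = trans
    (∙-cong (ΣS-ε (λ T → f≈ε (true ∷ T) λ ()))
            (ΣS-single p (λ T T≢p → f≈ε (false ∷ T) (T≢p ∘ ∷-injectiveʳ))))
    (identityˡ _)

  pairAt : Fin n → (Subset n → Carrier) → Subset n → Carrier
  pairAt e f T = if lookup T e then ε else f T ∙ f (T [ e ]≔ true)

  ΣS-pairAt : ∀ e (f : Subset n → Carrier) → ΣS n f ≈ ΣS n (pairAt e f)
  ΣS-pairAt {suc n} zero f = begin
    ΣS n (f ∘ (true ∷_)) ∙ ΣS n (f ∘ (false ∷_))  ≈⟨ comm _ _ ⟩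
    ΣS n (f ∘ (false ∷_)) ∙ ΣS n (f ∘ (true ∷_))  ≈⟨ ΣS-∙ (f ∘ (false ∷_)) (f ∘ (true ∷_)) ⟨
    ΣS n (λ T → f (false ∷ T) ∙ f (true ∷ T))      ≈⟨ identityˡ _ ⟨
    ε ∙ ΣS n (λ T → f (false ∷ T) ∙ f (true ∷ T))  ≈⟨ ∙-congʳ (ΣS-ε {n} (λ _ → ≈-refl)) ⟨
    ΣS (suc n) (pairAt zero f)                     ∎
  ΣS-pairAt {suc n} (suc e) f = ∙-cong (ΣS-pairAt e (f ∘ (true ∷_))) (ΣS-pairAt e (f ∘ (false ∷_)))

module SubsetSumGroup {c ℓ} (G : AbelianGroup c ℓ) where
  open AbelianGroup G
  open GroupProperties group using (∙-cancelˡ; ∙-cancelʳ)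
  open SubsetSum commutativeMonoid public

  ΣS-determines : ∀ {f h : Subset n → Carrier} p → (∀ T → T ≢ p → f T ≈ h T) →
                  ΣS n f ≈ ΣS n h → f p ≈ h p
  ΣS-determines {zero}  []         _   Σf≈Σh = Σf≈Σh
  ΣS-determines {suc n} (true ∷ p) f≈h Σf≈Σh = ΣS-determines p
    (λ T T≢p → f≈h (true ∷ T) (T≢p ∘ ∷-injectiveʳ))
    (∙-cancelʳ _ _ _ (trans Σf≈Σh (∙-congˡ (sym (ΣS-cong (λ T → f≈h (false ∷ T) λ ()))))))
  ΣS-determines {suc n} (false ∷ p) f≈h Σf≈Σh = ΣS-determines p
    (λ T T≢p → f≈h (false ∷ T) (T≢p ∘ ∷-injectiveʳ))
    (∙-cancelˡ _ _ _ (trans (∙-congʳ (sym (ΣS-cong (λ T → f≈h (true ∷ T) λ ())))) Σf≈Σh))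

-- Edelman–Jamison's characterisation of the convex sets of a convex geometry on X.
record IsConvexFamily (D : Subset n → Set) (X : Subset n) : Set where
  field
    ⊥-convex : D ⊥
    X-convex : D X
    ∩-closed : ∀ {U V} → U ⊆ X → V ⊆ X → D U → D V → D (U ∩ V)
    augment  : ∀ {U V} → U ⊆ V → V ⊆ X → D U → D V → U ≢ V →
               ∃ λ x → x ∈ V × x ∉ U × D (U ∪ ⁅ x ⁆)

Contract : (Subset n → Set) → Fin n → Subset n → Set
Contract D e U = D (U ∪ ⁅ e ⁆)

module _ {D : Subset n → Set} {X : Subset n} (fam : IsConvexFamily D X) where
  open IsConvexFamily fam

  ∃-extremePoint : Nonempty X → ∃ λ e → e ∈ X × D (X - e)
  ∃-extremePoint (x , x∈X) = climb (suc n) ⊥ (s≤s (∣p∣≤n (∁ ⊥))) ⊥-convex ⊥⊆ ⊥≢X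
    where
    ⊥≢X : ⊥ ≢ X
    ⊥≢X ⊥≡X = ∉⊥ (subst (x ∈_) (≡.sym ⊥≡X) x∈X)
    climb : ∀ m K → ∣ ∁ K ∣ < m → D K → K ⊆ X → K ≢ X → ∃ λ e → e ∈ X × D (X - e)
    climb (suc m) K ∣∁K∣<1+m K-convex K⊆X K≢X with augment K⊆X ⊆-refl K-convex X-convex K≢X
    ... | y , y∈X , y∉K , K∪y-convex with ≡-dec Bool._≟_ (K ∪ ⁅ y ⁆) X
    ...   | yes K∪y≡X = y , y∈X , subst D K≡X-y K-convex
      where
      K≡X-y : K ≡ X - y
      K≡X-y = ≡.trans (≡.sym (p∪⁅x⁆-x≡p y∉K)) (cong (_- y) K∪y≡X)
    ...   | no K∪y≢X = climb m (K ∪ ⁅ y ⁆) ∣∁K∪y∣<m K∪y-convex (p⊆r∧x∈r⇒p∪⁅x⁆⊆r K⊆X y∈X) K∪y≢X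
      where
      ∣∁K∪y∣<m : ∣ ∁ (K ∪ ⁅ y ⁆) ∣ < m
      ∣∁K∪y∣<m = ℕ.<-≤-trans
        (p⊂q⇒∣p∣<∣q∣ (p⊂q⇒∁p⊃∁q (p⊆p∪q ⁅ y ⁆ , y , x∈p∪⁅x⁆ K y , y∉K)))
        (ℕ.≤-pred ∣∁K∣<1+m)

  delete-isConvexFamily : ∀ {e} → D (X - e) → IsConvexFamily D (X - e)
  delete-isConvexFamily {e} X-e-convex = record
    { ⊥-convex = ⊥-convex
    ; X-convex = X-e-convex
    ; ∩-closed = λ U⊆ V⊆ → ∩-closed (x∈p-y⇒x∈p ∘ U⊆) (x∈p-y⇒x∈p ∘ V⊆)
    ; augment  = λ U⊆V V⊆ → augment U⊆V (x∈p-y⇒x∈p ∘ V⊆)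
    }

  contract-isConvexFamily : ∀ {e} → e ∈ X → Contract D e ⊥ → IsConvexFamily (Contract D e) (X - e)
  contract-isConvexFamily {e} e∈X e-convex = record
    { ⊥-convex = e-convex
    ; X-convex = subst D (≡.sym (p-x∪⁅x⁆≡p e∈X)) X-convex
    ; ∩-closed = λ {U} {V} U⊆ V⊆ U∪e-convex V∪e-convex →
        subst D (≡.sym (∪-distribʳ-∩ ⁅ e ⁆ U V)) (∩-closed (∪e⊆X U⊆) (∪e⊆X V⊆) U∪e-convex V∪e-convex)
    ; augment  = augment/e
    }
    where
    ∪e⊆X : ∀ {U} → U ⊆ X - e → U ∪ ⁅ e ⁆ ⊆ X
    ∪e⊆X U⊆ = p⊆r∧x∈r⇒p∪⁅x⁆⊆r (x∈p-y⇒x∈p ∘ U⊆) e∈X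
    augment/e : ∀ {U V} → U ⊆ V → V ⊆ X - e → Contract D e U → Contract D e V → U ≢ V →
                ∃ λ x → x ∈ V × x ∉ U × Contract D e (U ∪ ⁅ x ⁆)
    augment/e {U} {V} U⊆V V⊆ U∪e-convex V∪e-convex U≢V
      with augment (p⊆q⇒p∪⁅x⁆⊆q∪⁅x⁆ U⊆V) (∪e⊆X V⊆) U∪e-convex V∪e-convex
             (U≢V ∘ p∪⁅x⁆≡q∪⁅x⁆⇒p≡q (x∉p-x X e ∘ V⊆ ∘ U⊆V) (x∉p-x X e ∘ V⊆))
    ... | x , x∈V∪e , x∉U∪e , convex with x∈p∪⁅y⁆⁻ V x∈V∪e
    ...   | inj₂ refl = ⊥-elim (x∉U∪e (x∈p∪⁅x⁆ U x))
    ...   | inj₁ x∈V  = x , x∈V , x∉U∪e ∘ x∈p⇒x∈p∪⁅y⁆ e ,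
                        subst D (p∪⁅x⁆∪⁅y⁆≡p∪⁅y⁆∪⁅x⁆ U e x) convex

Free : (Subset n → Set) → Subset n → Subset n → Set
Free D X T = T ⊆ X × (∀ U → U ⊆ T → D U)

free? : ∀ {D : Subset n → Set} → (∀ U → Dec (D U)) → ∀ X T → Dec (Free D X T)
free? D? X T = T ⊆? X ×-dec ∀-subset? (λ U → U ⊆? T →-dec D? U)

¬Free-∪⁅e⁆ : ∀ {D : Subset n → Set} {X e T} → ¬ Free D (X - e) (T ∪ ⁅ e ⁆)
¬Free-∪⁅e⁆ {X = X} {e} {T} (T∪e⊆ , _) = x∉p-x X e (T∪e⊆ (x∈p∪⁅x⁆ T e))

module _ {D : Subset n → Set} {X : Subset n} {e : Fin n} where

  Free-delete : ∀ {T} → e ∉ T → Free D X T ⇔ Free D (X - e) T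
  Free-delete e∉T = mk⇔
    (λ (T⊆X , free) → (λ x∈T → x∈p∧x≢y⇒x∈p-y (T⊆X x∈T) λ { refl → e∉T x∈T }) , free)
    (λ (T⊆ , free) → x∈p-y⇒x∈p ∘ T⊆ , free)

  Free-contract : IsConvexFamily D X → e ∈ X → D (X - e) →
                  ∀ {T} → e ∉ T → Free D X (T ∪ ⁅ e ⁆) ⇔ Free (Contract D e) (X - e) T
  Free-contract fam e∈X X-e-convex {T} e∉T = mk⇔ to from
    where
    open IsConvexFamily fam
    to : Free D X (T ∪ ⁅ e ⁆) → Free (Contract D e) (X - e) T
    to (T∪e⊆X , free) =
      (λ x∈T → x∈p∧x≢y⇒x∈p-y (T∪e⊆X (x∈p⇒x∈p∪⁅y⁆ e x∈T)) λ { refl → e∉T x∈T }) ,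
      (λ U U⊆T → free (U ∪ ⁅ e ⁆) (p⊆q⇒p∪⁅x⁆⊆q∪⁅x⁆ U⊆T))
    from : Free (Contract D e) (X - e) T → Free D X (T ∪ ⁅ e ⁆)
    from (T⊆ , free) = p⊆r∧x∈r⇒p∪⁅x⁆⊆r (x∈p-y⇒x∈p ∘ T⊆) e∈X , convex
      where
      convex : ∀ U → U ⊆ T ∪ ⁅ e ⁆ → D U
      convex U U⊆ with e ∈? U
      ... | yes e∈U = subst D (p-x∪⁅x⁆≡p e∈U) (free (U - e) U-e⊆T)
        where
        U-e⊆T : U - e ⊆ T
        U-e⊆T x∈ with x∈p∪⁅y⁆⁻ T (U⊆ (x∈p-y⇒x∈p x∈))
        ... | inj₁ x∈T = x∈T
        ... | inj₂ x≡e = ⊥-elim (x∈p-y⇒x≢y x∈ x≡e)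
      ... | no e∉U = subst D (p⊆q∧x∉q⇒p∪⁅x⁆∩q≡p (T⊆ ∘ U⊆T) (x∉p-x X e))
                      (∩-closed (p⊆r∧x∈r⇒p∪⁅x⁆⊆r (x∈p-y⇒x∈p ∘ T⊆ ∘ U⊆T) e∈X) (x∈p-y⇒x∈p)
                                (free U U⊆T) X-e-convex)
        where
        U⊆T : U ⊆ T
        U⊆T x∈U with x∈p∪⁅y⁆⁻ T (U⊆ x∈U)
        ... | inj₁ x∈T = x∈T
        ... | inj₂ refl = ⊥-elim (e∉U x∈U)

-- The signed count of free sets

module FreeSetCount {c ℓ} (F : Field c ℓ) where
  open Field F hiding (_-_) renaming (refl to ≈-refl)
  open SubsetSumGroup +-abelianGroup
  open GroupProperties +-group using (⁻¹-involutive; ε⁻¹≈ε; identityˡ-unique)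
  open RingProperties ring using (-1*x≈-x)
  open import Relation.Binary.Reasoning.Setoid setoid

  indicator : ∀ {p} {P : Set p} → Dec P → Carrier → Carrier
  indicator (yes _) a = a
  indicator (no _)  _ = 0#

  module _ {p q} {P : Set p} {Q : Set q} where
    indicator-cong : ∀ (P? : Dec P) (Q? : Dec Q) {a b} → P ⇔ Q → a ≈ b → indicator P? a ≈ indicator Q? b
    indicator-cong (yes _) (yes _) _   a≈b = a≈b
    indicator-cong (yes p) (no ¬q) P⇔Q _   = ⊥-elim (¬q (Equivalence.to P⇔Q p))
    indicator-cong (no ¬p) (yes q) P⇔Q _   = ⊥-elim (¬p (Equivalence.from P⇔Q q))
    indicator-cong (no _)  (no _)  _   _   = ≈-refl

  indicator-yes : ∀ {p} {P : Set p} (P? : Dec P) {a} → P → indicator P? a ≈ a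
  indicator-yes (yes _) _ = ≈-refl
  indicator-yes (no ¬p) p = ⊥-elim (¬p p)

  indicator-no : ∀ {p} {P : Set p} (P? : Dec P) {a} → ¬ P → indicator P? a ≈ 0#
  indicator-no (yes p) ¬p = ⊥-elim (¬p p)
  indicator-no (no _)  _  = ≈-refl

  indicator-neg : ∀ {p} {P : Set p} (P? : Dec P) {a} → indicator P? (- a) ≈ - indicator P? a
  indicator-neg (yes _) = ≈-refl
  indicator-neg (no _)  = sym ε⁻¹≈ε

  indicator-*ˡ : ∀ {p} {P : Set p} (P? : Dec P) {a b} → indicator P? a * b ≈ indicator P? (a * b)
  indicator-*ˡ (yes _) = ≈-refl
  indicator-*ˡ (no _)  = zeroˡ _

  sign : Subset n → Carrier
  sign T = signPow F (size (∁ T))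

  sign-insert : ∀ (T : Subset n) {x} → x ∉ T → sign (T ∪ ⁅ x ⁆) ≈ - sign T
  sign-insert {n} T {x} x∉T = begin
    sign (T ∪ ⁅ x ⁆)            ≡⟨ cong sign (p[x]≔true≡p∪⁅x⁆ T x) ⟨
    sign T′                     ≈⟨ ⁻¹-involutive (sign T′) ⟨
    - (- sign T′)               ≈⟨ -‿cong (-1*x≈-x (sign T′)) ⟨
    - (- 1# * sign T′)          ≡⟨ cong (λ k → - signPow F k) (size∁-insert T x x∉T) ⟨
    - sign T                    ∎
    where
    T′ : Subset n
    T′ = T [ x ]≔ true

  count : ∀ {D : Subset n → Set} → (∀ U → Dec (D U)) → Subset n → Carrier
  count {n} D? X = ΣS n (λ T → indicator (free? D? X T) (sign T))

  count-⊥ : ∀ {D : Subset n → Set} (D? : ∀ U → Dec (D U)) → D ⊥ → count D? ⊥ ≈ sign {n} ⊥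
  count-⊥ {n} {D} D? ⊥-convex =
    trans (ΣS-single ⊥ T≢⊥⇒0) (indicator-yes (free? D? ⊥ ⊥) (⊆-refl , ⊥-free))
    where
    ⊆⊥⇒≡⊥ : ∀ {T : Subset n} → T ⊆ ⊥ → T ≡ ⊥
    ⊆⊥⇒≡⊥ T⊆⊥ = ⊆-antisym T⊆⊥ ⊥⊆
    ⊥-free : ∀ U → U ⊆ ⊥ → D U
    ⊥-free U U⊆⊥ = subst D (≡.sym (⊆⊥⇒≡⊥ U⊆⊥)) ⊥-convex
    T≢⊥⇒0 : ∀ T → T ≢ ⊥ → indicator (free? D? ⊥ T) (sign T) ≈ 0#
    T≢⊥⇒0 T T≢⊥ = indicator-no (free? D? ⊥ T) (T≢⊥ ∘ ⊆⊥⇒≡⊥ ∘ proj₁)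

  count-¬⊥ : ∀ {D : Subset n → Set} (D? : ∀ U → Dec (D U)) X → ¬ D ⊥ → count D? X ≈ 0#
  count-¬⊥ D? X ¬⊥-convex =
    ΣS-ε (λ T → indicator-no (free? D? X T) (λ (_ , free) → ¬⊥-convex (free ⊥ ⊥⊆)))

  -- Pair each T ∌ e with T ∪ ⁅ e ⁆: the former are free in X iff free in X - e, the latter iff
  -- T is free in the contraction, and they carry the opposite sign.
  count-delete-contract : ∀ {D : Subset n → Set} (D? : ∀ U → Dec (D U)) {X e} →
    IsConvexFamily D X → e ∈ X → D (X - e) →
    count D? X + count (D? ∘ (_∪ ⁅ e ⁆)) (X - e) ≈ count D? (X - e)
  count-delete-contract {n} {D} D? {X} {e} fam e∈X X-e-convex = begin
    count D? X + count D/e? Y                        ≈⟨ +-cong (ΣS-pairAt e f) (ΣS-pairAt e f/e) ⟩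
    ΣS n (pairAt e f) + ΣS n (pairAt e f/e)          ≈⟨ ΣS-∙ (pairAt e f) (pairAt e f/e) ⟨
    ΣS n (λ T → pairAt e f T + pairAt e f/e T)       ≈⟨ ΣS-cong pointwise ⟩
    ΣS n (pairAt e f-e)                              ≈⟨ ΣS-pairAt e f-e ⟨
    count D? Y                                       ∎
    where
    Y : Subset n
    Y = X - e
    D/e? : ∀ U → Dec (Contract D e U)
    D/e? = D? ∘ (_∪ ⁅ e ⁆)
    f f/e f-e : Subset n → Carrier
    f   T = indicator (free? D? X T) (sign T)
    f/e T = indicator (free? D/e? Y T) (sign T)
    f-e T = indicator (free? D? Y T) (sign T)
    pointwise : ∀ T → pairAt e f T + pairAt e f/e T ≈ pairAt e f-e T
    pointwise T with lookup T e in T[e]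
    ... | true  = +-identityʳ 0#
    ... | false = begin
      (f T + f (T [ e ]≔ true)) + (f/e T + f/e (T [ e ]≔ true))
        ≡⟨ cong (λ T∪e → (f T + f T∪e) + (f/e T + f/e T∪e)) (p[x]≔true≡p∪⁅x⁆ T e) ⟩
      (f T + f (T ∪ ⁅ e ⁆)) + (f/e T + f/e (T ∪ ⁅ e ⁆))
        ≈⟨ +-cong (+-cong f≈f-e f≈-f/e) (+-congˡ (indicator-no (free? D/e? Y (T ∪ ⁅ e ⁆)) ¬Free-∪⁅e⁆)) ⟩
      (f-e T + - f/e T) + (f/e T + 0#)
        ≈⟨ +-congˡ (+-identityʳ (f/e T)) ⟩
      (f-e T + - f/e T) + f/e T
        ≈⟨ +-assoc (f-e T) (- f/e T) (f/e T) ⟩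
      f-e T + (- f/e T + f/e T)
        ≈⟨ +-congˡ (-‿inverseˡ (f/e T)) ⟩
      f-e T + 0#
        ≈⟨ +-congˡ (indicator-no (free? D? Y (T ∪ ⁅ e ⁆)) ¬Free-∪⁅e⁆) ⟨
      f-e T + f-e (T ∪ ⁅ e ⁆)
        ≡⟨ cong (λ T∪e → f-e T + f-e T∪e) (p[x]≔true≡p∪⁅x⁆ T e) ⟨
      f-e T + f-e (T [ e ]≔ true) ∎
      where
      e∉T : e ∉ T
      e∉T e∈T with ≡.trans (≡.sym ([]=⇒lookup e∈T)) T[e]
      ... | ()
      f≈f-e : f T ≈ f-e T
      f≈f-e = indicator-cong (free? D? X T) (free? D? Y T) (Free-delete e∉T) ≈-refl
      f≈-f/e : f (T ∪ ⁅ e ⁆) ≈ - f/e T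
      f≈-f/e = trans
        (indicator-cong (free? D? X (T ∪ ⁅ e ⁆)) (free? D/e? Y T) (Free-contract fam e∈X X-e-convex e∉T)
                        (sign-insert T e∉T))
        (indicator-neg (free? D/e? Y T))

  count≈0 : ∀ {D : Subset n → Set} (D? : ∀ U → Dec (D U)) {X} →
            IsConvexFamily D X → Nonempty X → count D? X ≈ 0#
  count≈0 {n} D? {X} fam = bounded ∣ X ∣ D? fam ℕ.≤-refl
    where
    bounded : ∀ k {D : Subset n → Set} (D? : ∀ U → Dec (D U)) {X} →
              IsConvexFamily D X → ∣ X ∣ ≤ k → Nonempty X → count D? X ≈ 0#
    bounded zero D? fam ∣X∣≤0 (x , x∈X) = ⊥-elim (ℕ.n≮0 (ℕ.<-≤-trans (x∈p⇒∣p-x∣<∣p∣ x∈X) ∣X∣≤0))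
    bounded (suc k) {D} D? {X} fam ∣X∣≤1+k X-nonempty with ∃-extremePoint fam X-nonempty
    ... | e , e∈X , X-e-convex =
      identityˡ-unique _ _ (trans (count-delete-contract D? fam e∈X X-e-convex)
                                  (deletion≈contraction (nonempty? Y)))
      where
      open IsConvexFamily fam
      Y : Subset n
      Y = X - e
      ∣Y∣≤k : ∣ Y ∣ ≤ k
      ∣Y∣≤k = ℕ.≤-pred (ℕ.<-≤-trans (x∈p⇒∣p-x∣<∣p∣ e∈X) ∣X∣≤1+k)
      D/e? : ∀ U → Dec (Contract D e U)
      D/e? = D? ∘ (_∪ ⁅ e ⁆)
      deletion≈contraction : Dec (Nonempty Y) → count D? Y ≈ count D/e? Y
      deletion≈contraction (yes Y-nonempty) = trans
        (bounded k D? (delete-isConvexFamily fam X-e-convex) ∣Y∣≤k Y-nonempty)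
        (sym (contraction≈0 (D? (⊥ ∪ ⁅ e ⁆))))
        where
        contraction≈0 : Dec (Contract D e ⊥) → count D/e? Y ≈ 0#
        contraction≈0 (yes e-convex) =
          bounded k D/e? (contract-isConvexFamily fam e∈X e-convex) ∣Y∣≤k Y-nonempty
        contraction≈0 (no ¬e-convex) = count-¬⊥ D/e? Y ¬e-convex
      deletion≈contraction (no Y-empty) rewrite Empty-unique Y-empty =
        trans (count-⊥ D? ⊥-convex) (sym (count-⊥ D/e? e-convex))
        where
        e-convex : D (⊥ ∪ ⁅ e ⁆)
        e-convex = subst (λ Z → D (Z ∪ ⁅ e ⁆)) (Empty-unique Y-empty)
                     (subst D (≡.sym (p-x∪⁅x⁆≡p e∈X)) X-convex)

convex? : ∀ (g : Op n) U → Dec (Convex g U)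
convex? g U = ≡-dec Bool._≟_ (g U) U

discrete? : ∀ (g : Op n) → Dec (Discrete g)
discrete? g = ∀-subset? (convex? g)

module _ {g : Op n} (cg : IsConvexGeometry g) where
  open IsConvexGeometry cg

  closure⊆ : ∀ {U V} → U ⊆ V → Convex g V → g U ⊆ V
  closure⊆ {V = V} U⊆V V-convex = subst (_ ⊆_) V-convex (monotone _ _ U⊆V)

  -- Replace x by a point of g (U ∪ ⁅ x ⁆) ∖ (U ∪ ⁅ x ⁆) until U ∪ ⁅ x ⁆ is convex;
  -- by anti-exchange each replacement strictly shrinks the closure.
  convex-augment : ∀ {U V} → U ⊆ V → Convex g U → Convex g V → U ≢ V →
                   ∃ λ x → x ∈ V × x ∉ U × Convex g (U ∪ ⁅ x ⁆)
  convex-augment {U} {V} U⊆V U-convex V-convex U≢V with p⊆q∧p≢q⇒p⊂q U⊆V U≢V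
  ... | _ , x₀ , x₀∈V , x₀∉U = descend (suc ∣ g (U ∪ ⁅ x₀ ⁆) ∣) x₀ ℕ.≤-refl x₀∈V x₀∉U
    where
    descend : ∀ m x → ∣ g (U ∪ ⁅ x ⁆) ∣ < m → x ∈ V → x ∉ U →
              ∃ λ x → x ∈ V × x ∉ U × Convex g (U ∪ ⁅ x ⁆)
    descend (suc m) x ∣W∣<1+m x∈V x∉U with convex? g (U ∪ ⁅ x ⁆)
    ... | yes U∪x-convex = x , x∈V , x∉U , U∪x-convex
    ... | no  U∪x-nonconvex
      with p⊆q∧p≢q⇒p⊂q (extensive (U ∪ ⁅ x ⁆)) (U∪x-nonconvex ∘ ≡.sym)
    ...   | _ , y , y∈W , y∉U∪x = descend m y ∣W′∣<m y∈V y∉U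
      where
      W : Subset n
      W = g (U ∪ ⁅ x ⁆)
      y∈V : y ∈ V
      y∈V = closure⊆ (p⊆r∧x∈r⇒p∪⁅x⁆⊆r U⊆V x∈V) V-convex y∈W
      y∉U : y ∉ U
      y∉U = y∉U∪x ∘ x∈p⇒x∈p∪⁅y⁆ x
      x∉W′ : x ∉ g (U ∪ ⁅ y ⁆)
      x∉W′ = antiExchange U y x (λ { refl → y∉U∪x (x∈p∪⁅x⁆ U x) })
               (y∉U ∘ subst (y ∈_) U-convex) (x∉U ∘ subst (x ∈_) U-convex) y∈W
      W′⊆W : g (U ∪ ⁅ y ⁆) ⊆ W
      W′⊆W = closure⊆ (p⊆r∧x∈r⇒p∪⁅x⁆⊆r (extensive _ ∘ x∈p⇒x∈p∪⁅y⁆ x) y∈W) (idempotent _)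
      ∣W′∣<m : ∣ g (U ∪ ⁅ y ⁆) ∣ < m
      ∣W′∣<m = ℕ.<-≤-trans (p⊂q⇒∣p∣<∣q∣ (W′⊆W , x , extensive _ (x∈p∪⁅x⁆ U x) , x∉W′)) (ℕ.≤-pred ∣W∣<1+m)

  ⊤-convex : Convex g ⊤
  ⊤-convex = ⊆-antisym ⊆⊤ (extensive ⊤)

  convexSets-isConvexFamily : IsConvexFamily (Convex g) ⊤
  convexSets-isConvexFamily = record
    { ⊥-convex = empty
    ; X-convex = ⊤-convex
    ; ∩-closed = λ {U} {V} _ _ U-convex V-convex → ⊆-antisym
        (λ x∈ → x∈p∩q⁺ (closure⊆ (p∩q⊆p U V) U-convex x∈ , closure⊆ (p∩q⊆q U V) V-convex x∈))
        (extensive _)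
    ; augment  = λ U⊆V _ → convex-augment U⊆V
    }

  module _ {S : Subset n} (S-convex : Convex g S) where

    restriction-isConvexGeometry : IsConvexGeometry (restriction g S)
    restriction-isConvexGeometry = record
      { extensive    = λ A i∈A → ∈-restr⁺ S _ (extensive _ (∈-lift⁺ S A i∈A))
      ; idempotent   = λ A → cong (restr S)
          (≡.trans (cong g (lift-restr S _ (closure⊆ (lift⊆ S A) S-convex))) (idempotent _))
      ; monotone     = λ A B A⊆B → restr-mono S (monotone _ _ (lift-mono S A⊆B))
      ; empty        = ≡.trans (cong (restr S) (≡.trans (cong g (lift-⊥ S)) empty)) (restr-⊥ S)
      ; antiExchange = λ A a b a≢b a∉ b∉ a∈ b∈ → antiExchange (lift S A) (enum S a) (enum S b)
          (a≢b ∘ enum-injective S) (a∉ ∘ ∈-restr⁺ S _) (b∉ ∘ ∈-restr⁺ S _)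
          (subst (λ Z → enum S a ∈ g Z) (lift-∪⁅⁆ S A b) (∈-restr⁻ S _ a∈))
          (subst (λ Z → enum S b ∈ g Z) (lift-∪⁅⁆ S A a) (∈-restr⁻ S _ b∈))
      }

    restriction-discrete⇔ : Discrete (restriction g S) ⇔ Free (Convex g) ⊤ S
    restriction-discrete⇔ = mk⇔ free discrete
      where
      open ≡.≡-Reasoning
      discrete : Free (Convex g) ⊤ S → Discrete (restriction g S)
      discrete (_ , free) A = ≡.trans (cong (restr S) (free (lift S A) (lift⊆ S A))) (restr-lift S A)
      subsets-convex : Discrete (restriction g S) → ∀ U → U ⊆ S → Convex g U
      subsets-convex discrete U U⊆S = begin
        g U                                       ≡⟨ lift-restr S (g U) (closure⊆ U⊆S S-convex) ⟨
        lift S (restr S (g U))                    ≡⟨ cong (lift S ∘ restr S ∘ g) (lift-restr S U U⊆S) ⟨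
        lift S (restriction g S (restr S U))      ≡⟨ cong (lift S) (discrete (restr S U)) ⟩
        lift S (restr S U)                        ≡⟨ lift-restr S U U⊆S ⟩
        U                                         ∎
      free : Discrete (restriction g S) → Free (Convex g) ⊤ S
      free discrete = ⊆⊤ , subsets-convex discrete

Free-⊤⇔discrete : ∀ {g : Op n} → Free (Convex g) ⊤ ⊤ ⇔ Discrete g
Free-⊤⇔discrete {g = g} = mk⇔ discrete free
  where
  free : Discrete g → Free (Convex g) ⊤ ⊤
  free discrete = ⊆⊤ , λ U _ → discrete U
  discrete : Free (Convex g) ⊤ ⊤ → Discrete g
  discrete (_ , free) U = free U ⊆⊤

module _ {c ℓ} (F : Field c ℓ) {ψ : Char F} (isψ : IsCharacter F ψ) where
  open Field F hiding (_-_)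
  open IsCharacter isψ

  character-subst : ∀ {m n} (m≡n : m ≡ n) (h : Op m) (g : Op n) → IsConvexGeometry g →
                    (∀ A → h (subst Subset (≡.sym m≡n) A) ≡ subst Subset (≡.sym m≡n) (g A)) →
                    ψ m h ≈ ψ n g
  character-subst refl h g cg h≗g = sym (extensional _ g h cg (≡.sym ∘ h≗g))

  character-restriction-⊤ : ∀ n (g : Op n) → IsConvexGeometry g →
                            ψ (size (⊤ {n})) (restriction g ⊤) ≈ ψ n g
  character-restriction-⊤ n g cg = character-subst (size⊤ n) (restriction g ⊤) g cg
    (λ A → ≡.trans (cong (restr ⊤ ∘ g) (lift-⊤ n A)) (restr-⊤ n (g A)))

-- The convolution inverse of η̄

module InverseOfηbar {c ℓ} (F : Field c ℓ) (ζ : Char F) (isζ : IsCharacter F ζ)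
                     (ζ-inverse : IsConvInverse F ζ (ηbar F)) where
  open Field F hiding (_-_; zero)
  open IsCharacter isζ
  open SubsetSumGroup +-abelianGroup
  open FreeSetCount F
  open import Relation.Binary.Reasoning.Setoid setoid

  sumF-allSubsets : ∀ (f : Subset n → Carrier) → sumF F (map f (allSubsets n)) ≈ ΣS n f
  sumF-allSubsets {zero}  f = +-identityʳ _
  sumF-allSubsets {suc n} f = begin
    sumF F (map f (map (true ∷_) L ++ᴸ map (false ∷_) L))
      ≡⟨ cong (sumF F) (List.map-++ f (map (true ∷_) L) (map (false ∷_) L)) ⟩
    sumF F (map f (map (true ∷_) L) ++ᴸ map f (map (false ∷_) L))
      ≈⟨ sumF-++ (map f (map (true ∷_) L)) (map f (map (false ∷_) L)) ⟩
    sumF F (map f (map (true ∷_) L)) + sumF F (map f (map (false ∷_) L))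
      ≡⟨ cong₂ (λ xs ys → sumF F xs + sumF F ys) (List.map-∘ L) (List.map-∘ L) ⟨
    sumF F (map (f ∘ (true ∷_)) L) + sumF F (map (f ∘ (false ∷_)) L)
      ≈⟨ +-cong (sumF-allSubsets (f ∘ (true ∷_))) (sumF-allSubsets (f ∘ (false ∷_))) ⟩
    ΣS (suc n) f ∎
    where
    L : List (Subset n)
    L = allSubsets n
    sumF-++ : ∀ (xs ys : List Carrier) → sumF F (xs ++ᴸ ys) ≈ sumF F xs + sumF F ys
    sumF-++ []       ys = sym (+-identityˡ _)
    sumF-++ (x ∷ xs) ys = trans (+-congˡ (sumF-++ xs ys)) (sym (+-assoc _ _ _))

  -- Definitionally the summand of conv ζ (ηbar F) n g.
  convTerm : Op n → Subset n → Carrier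
  convTerm g S = if does (convex? g S) then ζ (size S) (restriction g S) * sign S else 0#

  ΣS-convTerm : ∀ n (g : Op (suc n)) → IsConvexGeometry g → ΣS (suc n) (convTerm g) ≈ 0#
  ΣS-convTerm n g cg = trans (sym (sumF-allSubsets (convTerm g))) (proj₁ (ζ-inverse (suc n) g cg))

  convTerm-⊤ : ∀ (g : Op n) → IsConvexGeometry g → convTerm g ⊤ ≈ ζ n g
  convTerm-⊤ {n} g cg with convex? g ⊤
  ... | no ⊤-nonconvex = ⊥-elim (⊤-nonconvex (⊤-convex cg))
  ... | yes _ = begin
    ζ′ * sign (⊤ {n})                   ≡⟨ cong (λ k → ζ′ * signPow F k) (size∁⊤ n) ⟩
    ζ′ * 1#                             ≈⟨ *-identityʳ ζ′ ⟩
    ζ′                                  ≈⟨ character-restriction-⊤ F isζ n g cg ⟩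
    ζ n g                               ∎
    where
    ζ′ : Carrier
    ζ′ = ζ (size (⊤ {n})) (restriction g ⊤)

  IndicatesDiscreteness : ℕ → Set ℓ
  IndicatesDiscreteness n = ∀ (g : Op n) → IsConvexGeometry g → ζ n g ≈ indicator (discrete? g) 1#

  -- Off S = ⊤ the summands of (ζ * η̄)(g) are, by induction, those of the signed count of free sets,
  -- and both sums vanish; so they also agree at S = ⊤.
  indicatesDiscreteness-step : ∀ n → (∀ {m} → m < suc n → IndicatesDiscreteness m) →
                               IndicatesDiscreteness (suc n)
  indicatesDiscreteness-step n ih g cg = begin
    ζ (suc n) g                 ≈⟨ convTerm-⊤ g cg ⟨
    convTerm g ⊤                ≈⟨ ΣS-determines ⊤ convTerm≈freeTerm ΣconvTerm≈ΣfreeTerm ⟩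
    freeTerm ⊤                  ≈⟨ freeTerm-⊤ ⟩
    indicator (discrete? g) 1#  ∎
    where
    freeTerm : Subset (suc n) → Carrier
    freeTerm T = indicator (free? (convex? g) ⊤ T) (sign T)

    ΣconvTerm≈ΣfreeTerm : ΣS (suc n) (convTerm g) ≈ ΣS (suc n) freeTerm
    ΣconvTerm≈ΣfreeTerm = trans (ΣS-convTerm n g cg)
      (sym (count≈0 (convex? g) (convexSets-isConvexFamily cg) (zero , ∈⊤)))

    freeTerm-⊤ : freeTerm ⊤ ≈ indicator (discrete? g) 1#
    freeTerm-⊤ = indicator-cong (free? (convex? g) ⊤ ⊤) (discrete? g) Free-⊤⇔discrete
      (reflexive (cong (signPow F) (size∁⊤ (suc n))))

    convTerm≈freeTerm : ∀ S → S ≢ ⊤ → convTerm g S ≈ freeTerm S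
    convTerm≈freeTerm S S≢⊤ with convex? g S
    ... | no S-nonconvex =
      sym (indicator-no (free? (convex? g) ⊤ S) (λ (_ , free) → S-nonconvex (free S ⊆-refl)))
    ... | yes S-convex = begin
      ζ (size S) (restriction g S) * sign S       ≈⟨ *-congʳ (ih (p≢⊤⇒size<n S S≢⊤) _ g|S-geometry) ⟩
      indicator g|S-discrete? 1# * sign S         ≈⟨ indicator-*ˡ g|S-discrete? ⟩
      indicator g|S-discrete? (1# * sign S)       ≈⟨ indicator-cong g|S-discrete? (free? (convex? g) ⊤ S)
                                                       (restriction-discrete⇔ cg S-convex) (*-identityˡ _) ⟩
      freeTerm S                                  ∎
      where
      g|S-geometry : IsConvexGeometry (restriction g S)
      g|S-geometry = restriction-isConvexGeometry cg S-convex
      g|S-discrete? : Dec (Discrete (restriction g S))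
      g|S-discrete? = discrete? (restriction g S)

  indicatesDiscreteness : ∀ n → IndicatesDiscreteness n
  indicatesDiscreteness = <-rec IndicatesDiscreteness step
    where
    step : ∀ n → (∀ {m} → m < n → IndicatesDiscreteness m) → IndicatesDiscreteness n
    step zero    _  g cg = trans (unit g cg) (sym (indicator-yes (discrete? g) λ { [] → empty }))
      where open IsConvexGeometry cg
    step (suc n) ih = indicatesDiscreteness-step n ih

mainTheorem9 : ∀ {c ℓ : Level} (F : Field c ℓ) → CharNot2 F →
    (ζ : Char F) → IsCharacter F ζ → IsConvInverse F ζ (ηbar F) →
    ∀ (n : ℕ) (g : Op n) → IsConvexGeometry g →
      (Discrete g → Field._≈_ F (ζ n g) (Field.1# F)) ×
      (¬ Discrete g → Field._≈_ F (ζ n g) (Field.0# F))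
mainTheorem9 F _ ζ isζ inverse n g cg =
    (λ discrete → trans ζ≈[discrete] (indicator-yes (discrete? g) discrete))
  , (λ ¬discrete → trans ζ≈[discrete] (indicator-no (discrete? g) ¬discrete))
  where
  open Field F using (_≈_; 1#; trans)
  open FreeSetCount F using (indicator; indicator-yes; indicator-no)
  ζ≈[discrete] : ζ n g ≈ indicator (discrete? g) 1#
  ζ≈[discrete] = InverseOfηbar.indicatesDiscreteness F ζ isζ inverse n g cg
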